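{- Let $O=(0,0,0)$. The set of all equilateral triangles with vertices in $\mathbb{Z}^3$, one vertex equal to $O$ and the other two lying in the plane $\{(\alpha,\beta,\gamma):5\alpha+7\beta+13\gamma=0\}$ equals $$\{\,\{O,(7m+5n,\,8m-11n,\,-7m+4n),\,(12m-7n,\,-3m-8n,\,-3m+7n)\} : m,n\in\mathbb{Z},\ (m,n)\neq(0,0)\,\},$$ and the triangle corresponding to $(m,n)$ has side length $9\sqrt{2(m^2-mn+n^2)}$.
   Context: Triangles are regarded as unordered sets of three vertices. -}

module Defs where

open import Data.Integer using (ℤ; +_; _+_; _-_; _*_; -_)
open import Data.Product using (_×_; _,_; Σ; ∃₂)
open import Data.Sum using (_⊎_)
open import Relation.Binary.PropositionalEquality using (_≡_)
open import Relation.Nullary using (¬_)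

Point : Set
Point = ℤ × ℤ × ℤ

O : Point
O = + 0 , + 0 , + 0

sqDist : Point → Point → ℤ
sqDist (a₁ , a₂ , a₃) (b₁ , b₂ , b₃) =
  (a₁ - b₁) * (a₁ - b₁) + (a₂ - b₂) * (a₂ - b₂) + (a₃ - b₃) * (a₃ - b₃)

InPlane : Point → Set
InPlane (a , b , c) = + 5 * a + + 7 * b + + 13 * c ≡ + 0

-- a triangle is given by three vertices; it is regarded as the unordered
-- set of its vertices (see _≈T_ below)
record Triangle : Set where
  constructor tri
  field
    v₁ v₂ v₃ : Point

open Triangle public

_∈T_ : Point → Triangle → Set
p ∈T tri a b c = (p ≡ a) ⊎ (p ≡ b) ⊎ (p ≡ c)

_≈T_ : Triangle → Triangle → Set
T ≈T T' = ∀ p → ((p ∈T T → p ∈T T') × (p ∈T T' → p ∈T T))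

Equilateral : Triangle → Set
Equilateral (tri a b c) =
  (sqDist a b ≡ sqDist b c) × (sqDist b c ≡ sqDist c a) × ¬ (sqDist a b ≡ + 0)

OneVertexOOthersInPlane : Triangle → Set
OneVertexOOthersInPlane (tri a b c) =
    (a ≡ O × InPlane b × InPlane c)
  ⊎ (b ≡ O × InPlane a × InPlane c)
  ⊎ (c ≡ O × InPlane a × InPlane b)

P : ℤ → ℤ → Point
P m n = + 7 * m + + 5 * n , + 8 * m - + 11 * n , - (+ 7) * m + + 4 * n

Q : ℤ → ℤ → Point
Q m n = + 12 * m - + 7 * n , - (+ 3) * m - + 8 * n , - (+ 3) * m + + 7 * n

triMN : ℤ → ℤ → Triangle
triMN m n = tri O (P m n) (Q m n)

NotBothZero : ℤ → ℤ → Set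
NotBothZero m n = ¬ ((m ≡ + 0) × (n ≡ + 0))

-- The normal N = (5, 7, 13) of the plane has ‖N‖² = 243 = 3 · 9², so on the plane the maps
-- x ↦ (9 x ∓ N ⨯ x) / 18 are the rotations by ±60° about N.  For an equilateral triangle O x y
-- in the plane, the defects D = 18 y - 9 x + N ⨯ x and D′ = 18 x - 9 y + N ⨯ y satisfy
-- D · D′ = 0 and D ⨯ D′ = O, both being combinations of the hypotheses; by Lagrange's identity
-- ‖D‖² ‖D′‖² = (D · D′)² + ‖D ⨯ D′‖² one of them vanishes, i.e. one vertex is the other one
-- turned by 60°.  Integrality of the turned vertex then forces the two vertices to be P m n and
-- Q m n.  Conversely every side of triMN m n has squared length 162 (m² - m n + n²), which is
-- positive for (m , n) ≠ (0 , 0) since 2 (m² - m n + n²) = m² + n² + (m - n)².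

module Submission where

open import Defs
open import Data.Integer using (ℤ; NonZero; +_; -[1+_]; _+_; _-_; _*_; -_; ∣_∣)
open import Data.Integer.Properties
  using ( +◃n≡+n; +-injective; ∣i∣≡0⇒i≡0; i*j≡0⇒i≡0∨j≡0; i≡j⇒i-j≡0; i-j≡0⇒i≡j
        ; *-cancelˡ-≡; *-zeroʳ)
open import Data.Integer.Tactic.RingSolver using (solve-∀)
import Data.Nat as ℕ
import Data.Nat.Properties as ℕ
open import Data.Product using (_×_; _,_; proj₁; proj₂; ∃₂)
import Data.Product as Product
open import Data.Sum using (_⊎_; inj₁; inj₂; [_,_]′)
import Data.Sum as Sum
open import Data.Empty using (⊥; ⊥-elim)
open import Function using (_∘_; id)
open import Relation.Nullary using (¬_)
open import Relation.Binary.PropositionalEquality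
  using (_≡_; _≢_; refl; sym; trans; cong₂; module ≡-Reasoning)

infix 8 _·_
infix 9 _⨯_

_·_ : Point → Point → ℤ
(a₁ , a₂ , a₃) · (b₁ , b₂ , b₃) = a₁ * b₁ + a₂ * b₂ + a₃ * b₃

_⨯_ : Point → Point → Point
(a₁ , a₂ , a₃) ⨯ (b₁ , b₂ , b₃) = a₂ * b₃ - a₃ * b₂ , a₃ * b₁ - a₁ * b₃ , a₁ * b₂ - a₂ * b₁

‖_‖² : Point → ℤ
‖ a ‖² = a · a

≡O⇒components≡0 : ∀ {u v w} → (u , v , w) ≡ O → u ≡ + 0 × v ≡ + 0 × w ≡ + 0
≡O⇒components≡0 refl = refl , refl , refl

square≡+∣∣*∣∣ : ∀ i → i * i ≡ + (∣ i ∣ ℕ.* ∣ i ∣)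
square≡+∣∣*∣∣ (+ n)    = +◃n≡+n (n ℕ.* n)
square≡+∣∣*∣∣ -[1+ n ] = +◃n≡+n _

∣∣*∣∣≡0⇒≡0 : ∀ i → ∣ i ∣ ℕ.* ∣ i ∣ ≡ 0 → i ≡ + 0
∣∣*∣∣≡0⇒≡0 i eq = ∣i∣≡0⇒i≡0 (Sum.reduce (ℕ.m*n≡0⇒m≡0∨n≡0 ∣ i ∣ eq))

‖‖²≡0⇒≡O : ∀ s → ‖ s ‖² ≡ + 0 → s ≡ O
‖‖²≡0⇒≡O (a , b , c) eq
  rewrite square≡+∣∣*∣∣ a | square≡+∣∣*∣∣ b | square≡+∣∣*∣∣ c =
  cong₂ _,_ (∣∣*∣∣≡0⇒≡0 a (ℕ.m+n≡0⇒m≡0 _ a²+b²≡0))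
    (cong₂ _,_ (∣∣*∣∣≡0⇒≡0 b (ℕ.m+n≡0⇒n≡0 _ a²+b²≡0))
               (∣∣*∣∣≡0⇒≡0 c (ℕ.m+n≡0⇒n≡0 _ (+-injective eq))))
  where
  a²+b²≡0 : ∣ a ∣ ℕ.* ∣ a ∣ ℕ.+ ∣ b ∣ ℕ.* ∣ b ∣ ≡ 0
  a²+b²≡0 = ℕ.m+n≡0⇒m≡0 _ (+-injective eq)

k*i≡0⇒i≡0 : ∀ k {i} .{{_ : NonZero k}} → k * i ≡ + 0 → i ≡ + 0
k*i≡0⇒i≡0 k {i} eq = *-cancelˡ-≡ k i (+ 0) (trans eq (sym (*-zeroʳ k)))

combination-of-zeros : ∀ {a b c d} p q r s → a ≡ + 0 → b ≡ + 0 → c ≡ + 0 → d ≡ + 0 →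
                       a * p + b * q + c * r + d * s ≡ + 0
combination-of-zeros _ _ _ _ refl refl refl refl = refl

lagrange-identity : ∀ s t → ‖ s ‖² * ‖ t ‖² ≡ (s · t) * (s · t) + ‖ s ⨯ t ‖²
lagrange-identity (s₁ , s₂ , s₃) (t₁ , t₂ , t₃) = identity s₁ s₂ s₃ t₁ t₂ t₃
  where
  identity : ∀ s₁ s₂ s₃ t₁ t₂ t₃ →
    let st = s₁ * t₁ + s₂ * t₂ + s₃ * t₃
        c₁ = s₂ * t₃ - s₃ * t₂
        c₂ = s₃ * t₁ - s₁ * t₃
        c₃ = s₁ * t₂ - s₂ * t₁
    in (s₁ * s₁ + s₂ * s₂ + s₃ * s₃) * (t₁ * t₁ + t₂ * t₂ + t₃ * t₃)
       ≡ st * st + (c₁ * c₁ + c₂ * c₂ + c₃ * c₃)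
  identity = solve-∀

orthogonal-parallel⇒≡O : ∀ {s t} → s · t ≡ + 0 → s ⨯ t ≡ O → s ≡ O ⊎ t ≡ O
orthogonal-parallel⇒≡O {s} {t} s·t≡0 s⨯t≡O =
  Sum.map (‖‖²≡0⇒≡O s) (‖‖²≡0⇒≡O t) (i*j≡0⇒i≡0∨j≡0 ‖ s ‖² ‖s‖²‖t‖²≡0)
  where
  open ≡-Reasoning
  ‖s‖²‖t‖²≡0 : ‖ s ‖² * ‖ t ‖² ≡ + 0
  ‖s‖²‖t‖²≡0 = begin
    ‖ s ‖² * ‖ t ‖²                ≡⟨ lagrange-identity s t ⟩
    (s · t) * (s · t) + ‖ s ⨯ t ‖²  ≡⟨ cong₂ (λ d c → d * d + ‖ c ‖²) s·t≡0 s⨯t≡O ⟩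
    + 0                            ∎

sqDist-comm : ∀ a b → sqDist a b ≡ sqDist b a
sqDist-comm (a₁ , a₂ , a₃) (b₁ , b₂ , b₃) = identity a₁ a₂ a₃ b₁ b₂ b₃
  where
  identity : ∀ a₁ a₂ a₃ b₁ b₂ b₃ →
    (a₁ - b₁) * (a₁ - b₁) + (a₂ - b₂) * (a₂ - b₂) + (a₃ - b₃) * (a₃ - b₃)
    ≡ (b₁ - a₁) * (b₁ - a₁) + (b₂ - a₂) * (b₂ - a₂) + (b₃ - a₃) * (b₃ - a₃)
  identity = solve-∀

sqDist-self : ∀ a → sqDist a a ≡ + 0
sqDist-self (a₁ , a₂ , a₃) = identity a₁ a₂ a₃
  where
  identity : ∀ a₁ a₂ a₃ →
    (a₁ - a₁) * (a₁ - a₁) + (a₂ - a₂) * (a₂ - a₂) + (a₃ - a₃) * (a₃ - a₃) ≡ + 0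
  identity = solve-∀

sqDist≢0⇒≢ : ∀ {a b} → ¬ sqDist a b ≡ + 0 → a ≢ b
sqDist≢0⇒≢ {a} sqDist≢0 refl = sqDist≢0 (sqDist-self a)

sqDist≡0⇒≡ : ∀ a b → sqDist a b ≡ + 0 → a ≡ b
sqDist≡0⇒≡ (a₁ , a₂ , a₃) (b₁ , b₂ , b₃) eq =
  let (d₁≡0 , d₂≡0 , d₃≡0) = ≡O⇒components≡0 (‖‖²≡0⇒≡O (a₁ - b₁ , a₂ - b₂ , a₃ - b₃) eq)
  in cong₂ _,_ (i-j≡0⇒i≡j a₁ b₁ d₁≡0)
       (cong₂ _,_ (i-j≡0⇒i≡j a₂ b₂ d₂≡0) (i-j≡0⇒i≡j a₃ b₃ d₃≡0))

≈T-refl : ∀ {T} → T ≈T T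
≈T-refl _ = id , id

≈T-sym : ∀ {T T′} → T ≈T T′ → T′ ≈T T
≈T-sym T≈T′ p = Product.swap (T≈T′ p)

≈T-trans : ∀ {T T′ T″} → T ≈T T′ → T′ ≈T T″ → T ≈T T″
≈T-trans T≈T′ T′≈T″ p = proj₁ (T′≈T″ p) ∘ proj₁ (T≈T′ p) , proj₂ (T≈T′ p) ∘ proj₂ (T′≈T″ p)

≈T-rotate : ∀ {a b c} → tri a b c ≈T tri b c a
≈T-rotate _ = Sum.assocʳ ∘ Sum.swap , Sum.swap ∘ Sum.assocˡ

≈T-swap : ∀ {a b c} → tri a b c ≈T tri a c b
≈T-swap _ = Sum.map₂ Sum.swap , Sum.map₂ Sum.swap

Nondegenerate : Triangle → Set
Nondegenerate (tri a b c) = a ≢ b × b ≢ c × c ≢ a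

Equilateral⇒Nondegenerate : ∀ {T} → Equilateral T → Nondegenerate T
Equilateral⇒Nondegenerate {tri a b c} (ab≡bc , bc≡ca , ab≢0) =
    sqDist≢0⇒≢ ab≢0
  , sqDist≢0⇒≢ (ab≢0 ∘ trans ab≡bc)
  , sqDist≢0⇒≢ (ab≢0 ∘ trans ab≡bc ∘ trans bc≡ca)

Nondegenerate⇒¬⊆pair : ∀ {a b c u w} → Nondegenerate (tri a b c) →
                       a ≡ u ⊎ a ≡ w → b ≡ u ⊎ b ≡ w → c ≡ u ⊎ c ≡ w → ⊥
Nondegenerate⇒¬⊆pair (a≢b , _ , _) (inj₁ refl) (inj₁ refl) _ = a≢b refl
Nondegenerate⇒¬⊆pair (a≢b , _ , _) (inj₂ refl) (inj₂ refl) _ = a≢b refl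
Nondegenerate⇒¬⊆pair (_ , _ , c≢a) (inj₁ refl) (inj₂ refl) (inj₁ refl) = c≢a refl
Nondegenerate⇒¬⊆pair (_ , b≢c , _) (inj₁ refl) (inj₂ refl) (inj₂ refl) = b≢c refl
Nondegenerate⇒¬⊆pair (_ , b≢c , _) (inj₂ refl) (inj₁ refl) (inj₁ refl) = b≢c refl
Nondegenerate⇒¬⊆pair (_ , _ , c≢a) (inj₂ refl) (inj₁ refl) (inj₂ refl) = c≢a refl

≈T-Nondegenerate⇒≢₁₂ : ∀ {T u v w} → T ≈T tri u v w → Nondegenerate T → u ≢ v
≈T-Nondegenerate⇒≢₁₂ {tri a b c} {u} {_} {w} T≈ nd refl =
  Nondegenerate⇒¬⊆pair nd
    (vertex (inj₁ refl)) (vertex (inj₂ (inj₁ refl))) (vertex (inj₂ (inj₂ refl)))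
  where
  vertex : ∀ {p} → p ∈T tri a b c → p ≡ u ⊎ p ≡ w
  vertex {p} = [ inj₁ , id ]′ ∘ proj₁ (T≈ p)

Nondegenerate-resp-≈T : ∀ {T T′} → T ≈T T′ → Nondegenerate T → Nondegenerate T′
Nondegenerate-resp-≈T {T′ = tri u v w} T≈ nd =
    ≈T-Nondegenerate⇒≢₁₂ T≈ nd
  , ≈T-Nondegenerate⇒≢₁₂ (≈T-trans T≈ ≈T-rotate) nd
  , ≈T-Nondegenerate⇒≢₁₂ (≈T-trans T≈ (≈T-sym ≈T-rotate)) nd

Equilateral⇒sqDist≡side : ∀ {a b c p q} → Equilateral (tri a b c) →
                          p ∈T tri a b c → q ∈T tri a b c → p ≢ q → sqDist p q ≡ sqDist a b
Equilateral⇒sqDist≡side _ (inj₁ refl) (inj₁ refl) p≢q = ⊥-elim (p≢q refl)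
Equilateral⇒sqDist≡side _ (inj₁ refl) (inj₂ (inj₁ refl)) _ = refl
Equilateral⇒sqDist≡side {a} {b} {c} (ab≡bc , bc≡ca , _) (inj₁ refl) (inj₂ (inj₂ refl)) _ =
  trans (sqDist-comm a c) (sym (trans ab≡bc bc≡ca))
Equilateral⇒sqDist≡side {a} {b} _ (inj₂ (inj₁ refl)) (inj₁ refl) _ = sqDist-comm b a
Equilateral⇒sqDist≡side _ (inj₂ (inj₁ refl)) (inj₂ (inj₁ refl)) p≢q = ⊥-elim (p≢q refl)
Equilateral⇒sqDist≡side (ab≡bc , _ , _) (inj₂ (inj₁ refl)) (inj₂ (inj₂ refl)) _ = sym ab≡bc
Equilateral⇒sqDist≡side (ab≡bc , bc≡ca , _) (inj₂ (inj₂ refl)) (inj₁ refl) _ =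
  sym (trans ab≡bc bc≡ca)
Equilateral⇒sqDist≡side {a} {b} {c} (ab≡bc , _ , _) (inj₂ (inj₂ refl)) (inj₂ (inj₁ refl)) _ =
  trans (sqDist-comm c b) (sym ab≡bc)
Equilateral⇒sqDist≡side _ (inj₂ (inj₂ refl)) (inj₂ (inj₂ refl)) p≢q = ⊥-elim (p≢q refl)

Equilateral-resp-≈T : ∀ {T T′} → T ≈T T′ → Equilateral T → Equilateral T′
Equilateral-resp-≈T {tri a b c} {tri u v w} T≈ eq@(_ , _ , ab≢0) =
  let (u≢v , v≢w , w≢u) = Nondegenerate-resp-≈T T≈ (Equilateral⇒Nondegenerate eq)
      uv≡ab = side u∈ v∈ u≢v
      vw≡ab = side v∈ w∈ v≢w
      wu≡ab = side w∈ u∈ w≢u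
  in trans uv≡ab (sym vw≡ab) , trans vw≡ab (sym wu≡ab) , ab≢0 ∘ trans (sym uv≡ab)
  where
  side : ∀ {p q} → p ∈T tri a b c → q ∈T tri a b c → p ≢ q → sqDist p q ≡ sqDist a b
  side = Equilateral⇒sqDist≡side eq
  u∈ : u ∈T tri a b c
  u∈ = proj₂ (T≈ u) (inj₁ refl)
  v∈ : v ∈T tri a b c
  v∈ = proj₂ (T≈ v) (inj₂ (inj₁ refl))
  w∈ : w ∈T tri a b c
  w∈ = proj₂ (T≈ w) (inj₂ (inj₂ refl))

N : Point
N = + 5 , + 7 , + 13

turnDefect : Point → Point → Point
turnDefect x@(x₁ , x₂ , x₃) (y₁ , y₂ , y₃) =
  let (n₁ , n₂ , n₃) = N ⨯ x
  in + 18 * y₁ - + 9 * x₁ + n₁ , + 18 * y₂ - + 9 * x₂ + n₂ , + 18 * y₃ - + 9 * x₃ + n₃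

turnDefects-orthogonal : ∀ {x y} → InPlane x → InPlane y → Equilateral (tri O x y) →
                         turnDefect x y · turnDefect y x ≡ + 0
turnDefects-orthogonal {x₁ , x₂ , x₃} {y₁ , y₂ , y₃} x∈ y∈ (ox≡xy , xy≡yo , _) =
  trans (identity x₁ x₂ x₃ y₁ y₂ y₃)
        (combination-of-zeros _ _ _ _ (i≡j⇒i-j≡0 ox≡xy) (i≡j⇒i-j≡0 xy≡yo) x∈ y∈)
  where
  identity : ∀ x₁ x₂ x₃ y₁ y₂ y₃ →
    let D₁ = + 18 * y₁ - + 9 * x₁ + (+ 7 * x₃ - + 13 * x₂)
        D₂ = + 18 * y₂ - + 9 * x₂ + (+ 13 * x₁ - + 5 * x₃)
        D₃ = + 18 * y₃ - + 9 * x₃ + (+ 5 * x₂ - + 7 * x₁)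
        D′₁ = + 18 * x₁ - + 9 * y₁ + (+ 7 * y₃ - + 13 * y₂)
        D′₂ = + 18 * x₂ - + 9 * y₂ + (+ 13 * y₁ - + 5 * y₃)
        D′₃ = + 18 * x₃ - + 9 * y₃ + (+ 5 * y₂ - + 7 * y₁)
        OX = (+ 0 - x₁) * (+ 0 - x₁) + (+ 0 - x₂) * (+ 0 - x₂) + (+ 0 - x₃) * (+ 0 - x₃)
        XY = (x₁ - y₁) * (x₁ - y₁) + (x₂ - y₂) * (x₂ - y₂) + (x₃ - y₃) * (x₃ - y₃)
        YO = (y₁ - + 0) * (y₁ - + 0) + (y₂ - + 0) * (y₂ - + 0) + (y₃ - + 0) * (y₃ - + 0)
        A = + 5 * x₁ + + 7 * x₂ + + 13 * x₃
        B = + 5 * y₁ + + 7 * y₂ + + 13 * y₃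
    in D₁ * D′₁ + D₂ * D′₂ + D₃ * D′₃
       ≡ (OX - XY) * + 162 + (XY - YO) * - + 162 + A * - B + B * + 0
  identity = solve-∀

-- The identity is D ⨯ D′ = (N · y) (D - 36 y) - (N · x) (D′ - 36 x) - 18 (‖x‖² - ‖y‖²) N,
-- dotted with c = D ⨯ D′.
turnDefects-parallel : ∀ {x y} → InPlane x → InPlane y → Equilateral (tri O x y) →
                       turnDefect x y ⨯ turnDefect y x ≡ O
turnDefects-parallel {x₁ , x₂ , x₃} {y₁ , y₂ , y₃} x∈ y∈ (ox≡xy , xy≡yo , _) =
  ‖‖²≡0⇒≡O _ (trans (identity x₁ x₂ x₃ y₁ y₂ y₃)
                     (combination-of-zeros _ _ _ _ (i≡j⇒i-j≡0 ox≡xy) (i≡j⇒i-j≡0 xy≡yo) x∈ y∈))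
  where
  identity : ∀ x₁ x₂ x₃ y₁ y₂ y₃ →
    let D₁ = + 18 * y₁ - + 9 * x₁ + (+ 7 * x₃ - + 13 * x₂)
        D₂ = + 18 * y₂ - + 9 * x₂ + (+ 13 * x₁ - + 5 * x₃)
        D₃ = + 18 * y₃ - + 9 * x₃ + (+ 5 * x₂ - + 7 * x₁)
        D′₁ = + 18 * x₁ - + 9 * y₁ + (+ 7 * y₃ - + 13 * y₂)
        D′₂ = + 18 * x₂ - + 9 * y₂ + (+ 13 * y₁ - + 5 * y₃)
        D′₃ = + 18 * x₃ - + 9 * y₃ + (+ 5 * y₂ - + 7 * y₁)
        c₁ = D₂ * D′₃ - D₃ * D′₂
        c₂ = D₃ * D′₁ - D₁ * D′₃
        c₃ = D₁ * D′₂ - D₂ * D′₁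
        OX = (+ 0 - x₁) * (+ 0 - x₁) + (+ 0 - x₂) * (+ 0 - x₂) + (+ 0 - x₃) * (+ 0 - x₃)
        XY = (x₁ - y₁) * (x₁ - y₁) + (x₂ - y₂) * (x₂ - y₂) + (x₃ - y₃) * (x₃ - y₃)
        YO = (y₁ - + 0) * (y₁ - + 0) + (y₂ - + 0) * (y₂ - + 0) + (y₃ - + 0) * (y₃ - + 0)
        A = + 5 * x₁ + + 7 * x₂ + + 13 * x₃
        B = + 5 * y₁ + + 7 * y₂ + + 13 * y₃
        c·N = + 5 * c₁ + + 7 * c₂ + + 13 * c₃
        c·[D-36y] = c₁ * (D₁ - + 36 * y₁) + c₂ * (D₂ - + 36 * y₂) + c₃ * (D₃ - + 36 * y₃)
        c·[D′-36x] = c₁ * (D′₁ - + 36 * x₁) + c₂ * (D′₂ - + 36 * x₂) + c₃ * (D′₃ - + 36 * x₃)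
    in c₁ * c₁ + c₂ * c₂ + c₃ * c₃
       ≡ (OX - XY) * (- + 18 * c·N) + (XY - YO) * (- + 18 * c·N)
         + A * - c·[D′-36x] + B * c·[D-36y]
  identity = solve-∀

equilateral⇒turn : ∀ {x y} → InPlane x → InPlane y → Equilateral (tri O x y) →
                   turnDefect x y ≡ O ⊎ turnDefect y x ≡ O
equilateral⇒turn {x} {y} x∈ y∈ eq =
  orthogonal-parallel⇒≡O {turnDefect x y} {turnDefect y x}
    (turnDefects-orthogonal {x} {y} x∈ y∈ eq) (turnDefects-parallel {x} {y} x∈ y∈ eq)

-- (m , n) is a left inverse of m , n ↦ (P m n , Q m n), and 18 (P m n - x) and 18 (Q m n - y)
-- are linear combinations of N · x and the components of the defect.
turn⇒PQ : ∀ {x y} → InPlane x → turnDefect x y ≡ O → ∃₂ λ m n → x ≡ P m n × y ≡ Q m n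
turn⇒PQ {x@(x₁ , x₂ , x₃)} {y@(y₁ , y₂ , y₃)} x∈ D≡O =
  let (D₁≡0 , D₂≡0 , D₃≡0) = ≡O⇒components≡0 D≡O
      vanishes = λ p q r s → combination-of-zeros p q r s x∈ D₁≡0 D₂≡0 D₃≡0
      18‖P-x‖²≡0 = trans (P-identity x₁ x₂ x₃ y₁ y₂ y₃) (vanishes _ _ _ _)
      18‖Q-y‖²≡0 = trans (Q-identity x₁ x₂ x₃ y₁ y₂ y₃) (vanishes _ _ _ _)
  in m , n , sym (sqDist≡0⇒≡ (P m n) x (k*i≡0⇒i≡0 (+ 18) 18‖P-x‖²≡0))
           , sym (sqDist≡0⇒≡ (Q m n) y (k*i≡0⇒i≡0 (+ 18) 18‖Q-y‖²≡0))
  where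
  m n : ℤ
  m = y₁ - y₂ + x₃ - x₁
  n = y₁ - y₃ + x₃ - x₂
  P-identity : ∀ x₁ x₂ x₃ y₁ y₂ y₃ →
    let m = y₁ - y₂ + x₃ - x₁
        n = y₁ - y₃ + x₃ - x₂
        e₁ = + 7 * m + + 5 * n - x₁
        e₂ = + 8 * m - + 11 * n - x₂
        e₃ = - (+ 7) * m + + 4 * n - x₃
        A = + 5 * x₁ + + 7 * x₂ + + 13 * x₃
        D₁ = + 18 * y₁ - + 9 * x₁ + (+ 7 * x₃ - + 13 * x₂)
        D₂ = + 18 * y₂ - + 9 * x₂ + (+ 13 * x₁ - + 5 * x₃)
        D₃ = + 18 * y₃ - + 9 * x₃ + (+ 5 * x₂ - + 7 * x₁)
    in + 18 * (e₁ * e₁ + e₂ * e₂ + e₃ * e₃)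
       ≡ A * (+ 4 * e₁ + + 2 * e₂ - + 4 * e₃) + D₁ * (+ 12 * e₁ - + 3 * e₂ - + 3 * e₃)
         + D₂ * (- + 7 * e₁ - + 8 * e₂ + + 7 * e₃) + D₃ * (- + 5 * e₁ + + 11 * e₂ - + 4 * e₃)
  P-identity = solve-∀
  Q-identity : ∀ x₁ x₂ x₃ y₁ y₂ y₃ →
    let m = y₁ - y₂ + x₃ - x₁
        n = y₁ - y₃ + x₃ - x₂
        e₁ = + 12 * m - + 7 * n - y₁
        e₂ = - (+ 3) * m - + 8 * n - y₂
        e₃ = - (+ 3) * m + + 7 * n - y₃
        A = + 5 * x₁ + + 7 * x₂ + + 13 * x₃
        D₁ = + 18 * y₁ - + 9 * x₁ + (+ 7 * x₃ - + 13 * x₂)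
        D₂ = + 18 * y₂ - + 9 * x₂ + (+ 13 * x₁ - + 5 * x₃)
        D₃ = + 18 * y₃ - + 9 * x₃ + (+ 5 * x₂ - + 7 * x₁)
    in + 18 * (e₁ * e₁ + e₂ * e₂ + e₃ * e₃)
       ≡ A * (+ 5 * e₁ - + 3 * e₂ - e₃) + D₁ * (+ 4 * e₁ - + 11 * e₂ + + 4 * e₃)
         + D₂ * (- + 12 * e₁ + + 2 * e₂ + + 3 * e₃) + D₃ * (+ 7 * e₁ + + 8 * e₂ - + 8 * e₃)
  Q-identity = solve-∀

PQ⇒≈triMN : ∀ {x y} → (∃₂ λ m n → x ≡ P m n × y ≡ Q m n) → ∃₂ λ m n → tri O x y ≈T triMN m n
PQ⇒≈triMN (m , n , refl , refl) = m , n , ≈T-refl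

QP⇒≈triMN : ∀ {x y} → (∃₂ λ m n → y ≡ P m n × x ≡ Q m n) → ∃₂ λ m n → tri O x y ≈T triMN m n
QP⇒≈triMN (m , n , refl , refl) = m , n , ≈T-swap

equilateral⇒≈triMN : ∀ {x y} → InPlane x → InPlane y → Equilateral (tri O x y) →
                     ∃₂ λ m n → tri O x y ≈T triMN m n
equilateral⇒≈triMN {x} {y} x∈ y∈ eq =
  [ PQ⇒≈triMN ∘ turn⇒PQ {x} {y} x∈ , QP⇒≈triMN ∘ turn⇒PQ {y} {x} y∈ ]′
    (equilateral⇒turn {x} {y} x∈ y∈ eq)

side² : ℤ → ℤ → ℤ
side² m n = + 81 * (+ 2 * (m * m - m * n + n * n))

triMN-sides : ∀ m n → sqDist O (P m n) ≡ side² m n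
                    × sqDist (P m n) (Q m n) ≡ side² m n
                    × sqDist (Q m n) O ≡ side² m n
triMN-sides m n = OP m n , PQ m n , QO m n
  where
  OP : ∀ m n →
    let p₁ = + 7 * m + + 5 * n ; p₂ = + 8 * m - + 11 * n ; p₃ = - (+ 7) * m + + 4 * n
    in (+ 0 - p₁) * (+ 0 - p₁) + (+ 0 - p₂) * (+ 0 - p₂) + (+ 0 - p₃) * (+ 0 - p₃)
       ≡ + 81 * (+ 2 * (m * m - m * n + n * n))
  OP = solve-∀
  PQ : ∀ m n →
    let p₁ = + 7 * m + + 5 * n ; p₂ = + 8 * m - + 11 * n ; p₃ = - (+ 7) * m + + 4 * n
        q₁ = + 12 * m - + 7 * n ; q₂ = - (+ 3) * m - + 8 * n ; q₃ = - (+ 3) * m + + 7 * n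
    in (p₁ - q₁) * (p₁ - q₁) + (p₂ - q₂) * (p₂ - q₂) + (p₃ - q₃) * (p₃ - q₃)
       ≡ + 81 * (+ 2 * (m * m - m * n + n * n))
  PQ = solve-∀
  QO : ∀ m n →
    let q₁ = + 12 * m - + 7 * n ; q₂ = - (+ 3) * m - + 8 * n ; q₃ = - (+ 3) * m + + 7 * n
    in (q₁ - + 0) * (q₁ - + 0) + (q₂ - + 0) * (q₂ - + 0) + (q₃ - + 0) * (q₃ - + 0)
       ≡ + 81 * (+ 2 * (m * m - m * n + n * n))
  QO = solve-∀

side²≡0⇒m≡0∧n≡0 : ∀ m n → side² m n ≡ + 0 → m ≡ + 0 × n ≡ + 0
side²≡0⇒m≡0∧n≡0 m n side²≡0 =
  let sum-of-squares≡0 = k*i≡0⇒i≡0 (+ 81) (trans (identity m n) side²≡0)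
      (m≡0 , n≡0 , _) = ≡O⇒components≡0 (‖‖²≡0⇒≡O (m , n , m - n) sum-of-squares≡0)
  in m≡0 , n≡0
  where
  identity : ∀ m n →
    + 81 * (m * m + n * n + (m - n) * (m - n)) ≡ + 81 * (+ 2 * (m * m - m * n + n * n))
  identity = solve-∀

triMN-equilateral : ∀ {m n} → NotBothZero m n → Equilateral (triMN m n)
triMN-equilateral {m} {n} mn≢0 =
  let (OP , PQ , QO) = triMN-sides m n
  in trans OP (sym PQ) , trans PQ (sym QO) , mn≢0 ∘ side²≡0⇒m≡0∧n≡0 m n ∘ trans (sym OP)

P-inPlane : ∀ m n → InPlane (P m n)
P-inPlane = identity
  where
  identity : ∀ m n →
    + 5 * (+ 7 * m + + 5 * n) + + 7 * (+ 8 * m - + 11 * n) + + 13 * (- (+ 7) * m + + 4 * n) ≡ + 0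
  identity = solve-∀

Q-inPlane : ∀ m n → InPlane (Q m n)
Q-inPlane = identity
  where
  identity : ∀ m n →
    + 5 * (+ 12 * m - + 7 * n) + + 7 * (- (+ 3) * m - + 8 * n) + + 13 * (- (+ 3) * m + + 7 * n)
    ≡ + 0
  identity = solve-∀

triMN-inPlane : ∀ {m n} p → p ∈T triMN m n → InPlane p
triMN-inPlane _ (inj₁ refl) = refl
triMN-inPlane {m} {n} _ (inj₂ (inj₁ refl)) = P-inPlane m n
triMN-inPlane {m} {n} _ (inj₂ (inj₂ refl)) = Q-inPlane m n

Nondegenerate⇒NotBothZero : ∀ {m n} → Nondegenerate (triMN m n) → NotBothZero m n
Nondegenerate⇒NotBothZero (O≢P , _) (refl , refl) = O≢P refl

rotate-O-first : ∀ T → OneVertexOOthersInPlane T → ∃₂ λ x y → InPlane x × InPlane y × T ≈T tri O x y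
rotate-O-first (tri _ b c) (inj₁ (refl , b∈ , c∈))        = b , c , b∈ , c∈ , ≈T-refl
rotate-O-first (tri a _ c) (inj₂ (inj₁ (refl , a∈ , c∈))) = c , a , c∈ , a∈ , ≈T-rotate
rotate-O-first (tri a b _) (inj₂ (inj₂ (refl , a∈ , b∈))) = a , b , a∈ , b∈ , ≈T-sym ≈T-rotate

O∈∧inPlane⇒OneVertexOOthersInPlane : ∀ {T} → O ∈T T → (∀ p → p ∈T T → InPlane p) →
                                      OneVertexOOthersInPlane T
O∈∧inPlane⇒OneVertexOOthersInPlane (inj₁ refl) inPlane =
  inj₁ (refl , inPlane _ (inj₂ (inj₁ refl)) , inPlane _ (inj₂ (inj₂ refl)))
O∈∧inPlane⇒OneVertexOOthersInPlane (inj₂ (inj₁ refl)) inPlane =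
  inj₂ (inj₁ (refl , inPlane _ (inj₁ refl) , inPlane _ (inj₂ (inj₂ refl))))
O∈∧inPlane⇒OneVertexOOthersInPlane (inj₂ (inj₂ refl)) inPlane =
  inj₂ (inj₂ (refl , inPlane _ (inj₁ refl) , inPlane _ (inj₂ (inj₁ refl))))

≈triMN⇒NotBothZero : ∀ {T m n} → Equilateral T → T ≈T triMN m n → NotBothZero m n
≈triMN⇒NotBothZero {T} {m} {n} eq T≈MN =
  Nondegenerate⇒NotBothZero {m} {n}
    (Nondegenerate-resp-≈T {T} {triMN m n} T≈MN (Equilateral⇒Nondegenerate eq))

equilateral-≈⇒parametrised : ∀ {T T′} → Equilateral T → T ≈T T′ →
                             (∃₂ λ m n → T′ ≈T triMN m n) →
                             ∃₂ λ m n → NotBothZero m n × T ≈T triMN m n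
equilateral-≈⇒parametrised {T} eq T≈T′ (m , n , T′≈MN) =
  m , n , ≈triMN⇒NotBothZero {T} {m} {n} eq T≈MN , T≈MN
  where
  T≈MN : T ≈T triMN m n
  T≈MN = ≈T-trans T≈T′ T′≈MN

equilateral⇒parametrised : ∀ T → Equilateral T × OneVertexOOthersInPlane T →
                           ∃₂ λ m n → NotBothZero m n × T ≈T triMN m n
equilateral⇒parametrised T (eq , O∈) = from-rotate-O-first (rotate-O-first T O∈)
  where
  from-rotate-O-first : (∃₂ λ x y → InPlane x × InPlane y × T ≈T tri O x y) →
                 ∃₂ λ m n → NotBothZero m n × T ≈T triMN m n
  from-rotate-O-first (x , y , x∈ , y∈ , T≈Oxy) =
    equilateral-≈⇒parametrised eq T≈Oxy
      (equilateral⇒≈triMN {x} {y} x∈ y∈ (Equilateral-resp-≈T T≈Oxy eq))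

parametrised⇒equilateral : ∀ T → (∃₂ λ m n → NotBothZero m n × T ≈T triMN m n) →
                           Equilateral T × OneVertexOOthersInPlane T
parametrised⇒equilateral T (m , n , mn≢0 , T≈MN) =
    Equilateral-resp-≈T {triMN m n} {T} (≈T-sym T≈MN) (triMN-equilateral {m} {n} mn≢0)
  , O∈∧inPlane⇒OneVertexOOthersInPlane (proj₂ (T≈MN O) (inj₁ refl))
                                       (λ p → triMN-inPlane {m} {n} p ∘ proj₁ (T≈MN p))

mainTheorem12 :
    ((T : Triangle) →
      ((Equilateral T × OneVertexOOthersInPlane T)
        → ∃₂ λ m n → NotBothZero m n × (T ≈T triMN m n))
      × ((∃₂ λ m n → NotBothZero m n × (T ≈T triMN m n))
        → Equilateral T × OneVertexOOthersInPlane T))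
    × ((m n : ℤ) → NotBothZero m n →
      (sqDist O (P m n) ≡ + 81 * (+ 2 * (m * m - m * n + n * n)))
      × (sqDist (P m n) (Q m n) ≡ + 81 * (+ 2 * (m * m - m * n + n * n)))
      × (sqDist (Q m n) O ≡ + 81 * (+ 2 * (m * m - m * n + n * n))))
mainTheorem12 =
  (λ T → equilateral⇒parametrised T , parametrised⇒equilateral T) , (λ m n _ → triMN-sides m n)
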